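{- Let $k\ge1$, $n\ge1$ and let $r:\mathfrak T^n\to\mathbb Z_{\ge0}$ be a rank function of a $k$-matroid. Then $r$ is $k$-submodular, i.e. $r(T\sqcap U)+r(T\sqcup U)\le r(T)+r(U)$ for all $T,U\in\mathfrak T^n$.
   Context: $\mathfrak T$ is a set consisting of a root $\mathbf o$ and a set $\mathfrak L$ of exactly $k$ leaves. Binary operations $\sqcap,\sqcup$ on $\mathfrak T$: $t\sqcap t=t\sqcup t=t$; for distinct leaves $a,b$: $a\sqcap b=a\sqcup b=\mathbf o$; for a leaf $a$: $a\sqcap\mathbf o=\mathbf o\sqcap a=\mathbf o$, $a\sqcup\mathbf o=\mathbf o\sqcup a=a$. They act componentwise on $\mathfrak T^n$; $\mathbf 0=(\mathbf o,\dots,\mathbf o)$. $T,U\in\mathfrak T^n$ are compatible if $|\{T_i,U_i\}\setminus\{\mathbf o\}|\le1$ for all $i$; they are $\bar i$-similar ($i\in\{1,\dots,n\}$) if $T_j=U_j$ for all $j\ne i$. A function $r:\mathfrak T^n\to\mathbb Z_{\ge0}$ is a rank function of a $k$-matroid if: (1) $r(\mathbf 0)=0$; (2) if $T,U$ are $\bar i$-similar and $T_i=\mathbf o$ then $r(T)\le r(U)\le r(T)+1$; (3) if $T,U$ are compatible then $r(T\sqcap U)+r(T\sqcup U)\le r(T)+r(U)$; (4) if $T,U$ are $\bar i$-similar and $|\{T_i,U_i\}\setminus\{\mathbf o\}|=2$ then $r(T\sqcap U)+r(T\sqcup U)\le r(T)+r(U)-1$. -}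

module Defs where

open import Data.Nat using (ℕ; _+_; _≤_; suc)
open import Data.Fin using (Fin; _≟_)
open import Data.Maybe using (Maybe; just; nothing)
open import Data.Product using (_×_)
open import Data.Sum using (_⊎_)
open import Relation.Nullary using (¬_; yes; no)
open import Relation.Binary.PropositionalEquality using (_≡_)

-- The tree 𝔗 with k leaves: nothing = root 𝐨, just a = leaf a.
𝔗 : ℕ → Set
𝔗 k = Maybe (Fin k)

𝐨 : ∀ {k} → 𝔗 k
𝐨 = nothing

_⊓₁_ : ∀ {k} → 𝔗 k → 𝔗 k → 𝔗 k
nothing ⊓₁ _ = nothing
just a ⊓₁ nothing = nothing
just a ⊓₁ just b with a ≟ b
... | yes _ = just a
... | no _ = nothing

_⊔₁_ : ∀ {k} → 𝔗 k → 𝔗 k → 𝔗 k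
nothing ⊔₁ t = t
just a ⊔₁ nothing = just a
just a ⊔₁ just b with a ≟ b
... | yes _ = just a
... | no _ = nothing

𝔗^ : ℕ → ℕ → Set
𝔗^ k n = Fin n → 𝔗 k

𝟎 : ∀ {k n} → 𝔗^ k n
𝟎 _ = nothing

_⊓_ : ∀ {k n} → 𝔗^ k n → 𝔗^ k n → 𝔗^ k n
(T ⊓ U) i = T i ⊓₁ U i

_⊔_ : ∀ {k n} → 𝔗^ k n → 𝔗^ k n → 𝔗^ k n
(T ⊔ U) i = T i ⊔₁ U i

-- |{s,t} \ {𝐨}| ≤ 1 : one of them is the root, or they are equal
CompatAt : ∀ {k} → 𝔗 k → 𝔗 k → Set
CompatAt s t = (s ≡ nothing) ⊎ ((t ≡ nothing) ⊎ (s ≡ t))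

-- |{s,t} \ {𝐨}| = 2 : two distinct leaves
TwoLeaves : ∀ {k} → 𝔗 k → 𝔗 k → Set
TwoLeaves s t = ¬ (s ≡ nothing) × (¬ (t ≡ nothing) × ¬ (s ≡ t))

Compatible : ∀ {k n} → 𝔗^ k n → 𝔗^ k n → Set
Compatible T U = ∀ i → CompatAt (T i) (U i)

Similar : ∀ {k n} → Fin n → 𝔗^ k n → 𝔗^ k n → Set
Similar i T U = ∀ j → ¬ (j ≡ i) → T j ≡ U j

record IsKMatroidRank (k n : ℕ) (r : 𝔗^ k n → ℕ) : Set where
  field
    r-zero : r 𝟎 ≡ 0
    r-unit : ∀ (i : Fin n) (T U : 𝔗^ k n) → Similar i T U → T i ≡ nothing →
             (r T ≤ r U) × (r U ≤ r T + 1)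
    r-compat : ∀ (T U : 𝔗^ k n) → Compatible T U →
               r (T ⊓ U) + r (T ⊔ U) ≤ r T + r U
    r-twoLeaves : ∀ (i : Fin n) (T U : 𝔗^ k n) → Similar i T U → TwoLeaves (T i) (U i) →
                  suc (r (T ⊓ U) + r (T ⊔ U)) ≤ r T + r U

KSubmodular : ∀ {k n} → (𝔗^ k n → ℕ) → Set
KSubmodular r = ∀ T U → r (T ⊓ U) + r (T ⊔ U) ≤ r T + r U

module Submission where

-- Axiom (3) already gives r(T ⊓ U) + r(T ⊔ U) ≤ r T + r U for compatible
-- T, U; the task is to remove incompatible coordinates, i.e. coordinates i
-- where T i = a and U i = b are distinct leaves.  Writing T' and U' for T and
-- U with coordinate i sent to the root, the pairs (T', U) and (T, U') have
-- one incompatible coordinate fewer, and the same meet T ⊓ U.  Their joins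
-- Wa = T ⊔ U' and Wb = T' ⊔ U are ī-similar with leaves a, b at i and satisfy
-- Wa ⊓ Wb = Wa ⊔ Wb = T ⊔ U, so axiom (4) applies to them.  Adding the three
-- inequalities and using r T' ≤ r T, r U' ≤ r U (axiom (2)) yields
-- 2 (r(T ⊓ U) + r(T ⊔ U)) + 1 ≤ 2 (r T + r U).

open import Defs
open import Data.Nat using (ℕ; _≥_; zero; suc; _+_; _≤_; _<_; z≤n)
open import Data.Nat.Properties
  using (≤-refl; ≤-trans; ≤-antisym; ≤-<-trans; +-mono-≤; +-monoʳ-≤; 1+n≰n; ≤∧≢⇒<; <⇒≢; ≰⇒>; <⇒≤; _≤?_; module ≤-Reasoning)
open import Data.Nat.Tactic.RingSolver using (solve-∀)
open import Data.Fin using (Fin; toℕ; fromℕ<; _≟_)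
open import Data.Fin.Properties using (toℕ<n; toℕ-fromℕ<; toℕ-injective)
open import Data.Vec.Functional using (updateAt)
open import Data.Vec.Functional.Properties using (updateAt-updates; updateAt-minimal)
open import Data.Maybe using (just; nothing)
open import Data.Product using (Σ-syntax; _×_; _,_; proj₁)
open import Data.Sum using (_⊎_; inj₁; inj₂)
open import Function using (const)
open import Relation.Nullary using (¬_; yes; no; contradiction)
open import Relation.Binary.PropositionalEquality

⊓₁-distinct : ∀ {k} {a b : Fin k} → ¬ a ≡ b → (just a ⊓₁ just b) ≡ 𝐨
⊓₁-distinct {a = a} {b} a≢b with a ≟ b
... | yes a≡b = contradiction a≡b a≢b
... | no _ = refl

⊔₁-distinct : ∀ {k} {a b : Fin k} → ¬ a ≡ b → (just a ⊔₁ just b) ≡ 𝐨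
⊔₁-distinct {a = a} {b} a≢b with a ≟ b
... | yes a≡b = contradiction a≡b a≢b
... | no _ = refl

⊓₁-idem : ∀ {k} (s : 𝔗 k) → (s ⊓₁ s) ≡ s
⊓₁-idem nothing = refl
⊓₁-idem (just a) with a ≟ a
... | yes _ = refl
... | no a≢a = contradiction refl a≢a

⊔₁-idem : ∀ {k} (s : 𝔗 k) → (s ⊔₁ s) ≡ s
⊔₁-idem nothing = refl
⊔₁-idem (just a) with a ≟ a
... | yes _ = refl
... | no a≢a = contradiction refl a≢a

⊓₁-𝐨 : ∀ {k} (s : 𝔗 k) → (s ⊓₁ 𝐨) ≡ 𝐨
⊓₁-𝐨 nothing = refl
⊓₁-𝐨 (just a) = refl

⊔₁-𝐨 : ∀ {k} (s : 𝔗 k) → (s ⊔₁ 𝐨) ≡ s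
⊔₁-𝐨 nothing = refl
⊔₁-𝐨 (just a) = refl

DistinctLeaves : ∀ {k} → 𝔗 k → 𝔗 k → Set
DistinctLeaves {k} s t = Σ[ a ∈ Fin k ] Σ[ b ∈ Fin k ] (s ≡ just a × t ≡ just b × ¬ a ≡ b)

compatAt-or-distinct : ∀ {k} (s t : 𝔗 k) → CompatAt s t ⊎ DistinctLeaves s t
compatAt-or-distinct nothing t = inj₁ (inj₁ refl)
compatAt-or-distinct (just a) nothing = inj₁ (inj₂ (inj₁ refl))
compatAt-or-distinct (just a) (just b) with a ≟ b
... | yes a≡b = inj₁ (inj₂ (inj₂ (cong just a≡b)))
... | no a≢b = inj₂ (a , b , refl , refl , a≢b)

distinct⇒twoLeaves : ∀ {k} {s t : 𝔗 k} → DistinctLeaves s t → TwoLeaves s t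
distinct⇒twoLeaves (a , b , refl , refl , a≢b) = (λ ()) , (λ ()) , λ { refl → a≢b refl }

module _ {k n : ℕ} {i : Fin n} where

  similar-refl : ∀ (T : 𝔗^ k n) → Similar i T T
  similar-refl T _ _ = refl

  similar-sym : ∀ {T U : 𝔗^ k n} → Similar i T U → Similar i U T
  similar-sym T~U j j≢i = sym (T~U j j≢i)

  similar-trans : ∀ {T U V : 𝔗^ k n} → Similar i T U → Similar i U V → Similar i T V
  similar-trans T~U U~V j j≢i = trans (T~U j j≢i) (U~V j j≢i)

  similar-⊓ : ∀ {T T' U U' : 𝔗^ k n} → Similar i T T' → Similar i U U' →
              Similar i (T ⊓ U) (T' ⊓ U')
  similar-⊓ T~T' U~U' j j≢i = cong₂ _⊓₁_ (T~T' j j≢i) (U~U' j j≢i)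

  similar-⊔ : ∀ {T T' U U' : 𝔗^ k n} → Similar i T T' → Similar i U U' →
              Similar i (T ⊔ U) (T' ⊔ U')
  similar-⊔ T~T' U~U' j j≢i = cong₂ _⊔₁_ (T~T' j j≢i) (U~U' j j≢i)

  similar-⊓-idem : ∀ (T : 𝔗^ k n) → Similar i (T ⊓ T) T
  similar-⊓-idem T j _ = ⊓₁-idem (T j)

  similar-⊔-idem : ∀ (T : 𝔗^ k n) → Similar i (T ⊔ T) T
  similar-⊔-idem T j _ = ⊔₁-idem (T j)

rootAt : ∀ {k n} → Fin n → 𝔗^ k n → 𝔗^ k n
rootAt i T = updateAt T i (const 𝐨)

rootAt-self : ∀ {k n} (i : Fin n) (T : 𝔗^ k n) → rootAt i T i ≡ 𝐨
rootAt-self i T = updateAt-updates i T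

rootAt-similar : ∀ {k n} (i : Fin n) (T : 𝔗^ k n) → Similar i (rootAt i T) T
rootAt-similar i T j j≢i = updateAt-minimal j i T j≢i

halve : ∀ x y → suc (x + x) ≤ y + y → x ≤ y
halve x y 2x<2y with x ≤? y
... | yes x≤y = x≤y
... | no x≰y = contradiction (≤-trans 2x<2y (+-mono-≤ y≤x y≤x)) 1+n≰n
  where y≤x = <⇒≤ (≰⇒> x≰y)

-- The arithmetic of the reduction step, with m = r(T ⊓ U), w = r(T ⊔ U),
-- wa = r Wa, wb = r Wb, t = r T, u = r U, t' = r T', u' = r U': adding the
-- three hypotheses on m, w, wa, wb and the two monotonicities gives
-- 2 (m + w) + 1 ≤ 2 (t + u).
combine : ∀ m w wa wb t u t' u' →
          m + wb ≤ t' + u → m + wa ≤ t + u' → suc (w + w) ≤ wa + wb →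
          t' ≤ t → u' ≤ u → m + w ≤ t + u
combine m w wa wb t u t' u' h₁ h₂ h₃ t'≤t u'≤u = halve (m + w) (t + u) (begin
    suc ((m + w) + (m + w)) ≡⟨ regroup₁ m w ⟩
    (m + m) + suc (w + w)   ≤⟨ +-monoʳ-≤ (m + m) h₃ ⟩
    (m + m) + (wa + wb)     ≡⟨ regroup₂ m wa wb ⟩
    (m + wa) + (m + wb)     ≤⟨ +-mono-≤ h₂ h₁ ⟩
    (t + u') + (t' + u)     ≡⟨ regroup₃ t u t' u' ⟩
    (t + u) + (t' + u')     ≤⟨ +-monoʳ-≤ (t + u) (+-mono-≤ t'≤t u'≤u) ⟩
    (t + u) + (t + u)       ∎)
  where
  open ≤-Reasoning
  regroup₁ : ∀ m w → suc ((m + w) + (m + w)) ≡ (m + m) + suc (w + w)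
  regroup₁ = solve-∀
  regroup₂ : ∀ m wa wb → (m + m) + (wa + wb) ≡ (m + wa) + (m + wb)
  regroup₂ = solve-∀
  regroup₃ : ∀ t u t' u' → (t + u') + (t' + u) ≡ (t + u) + (t' + u')
  regroup₃ = solve-∀

CompatibleFrom : ∀ {k n} → ℕ → 𝔗^ k n → 𝔗^ k n → Set
CompatibleFrom m T U = ∀ j → m ≤ toℕ j → CompatAt (T j) (U j)

above⇒≢ : ∀ {n m} (m<n : m < n) {j : Fin n} → suc m ≤ toℕ j → ¬ j ≡ fromℕ< m<n
above⇒≢ m<n {j} m<j j≡m = <⇒≢ m<j (sym (trans (cong toℕ j≡m) (toℕ-fromℕ< m<n)))

compatibleFrom-step : ∀ {k n m} (m<n : m < n) {T U : 𝔗^ k n} →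
                      CompatAt (T (fromℕ< m<n)) (U (fromℕ< m<n)) →
                      CompatibleFrom (suc m) T U → CompatibleFrom m T U
compatibleFrom-step {m = m} m<n atM fromM+1 j m≤j with j ≟ fromℕ< m<n
... | yes refl = atM
... | no j≢m = fromM+1 j (≤∧≢⇒< m≤j m≢j)
  where
  m≢j : ¬ m ≡ toℕ j
  m≢j m≡j = j≢m (toℕ-injective (trans (sym m≡j) (sym (toℕ-fromℕ< m<n))))

compatibleFrom-similarˡ : ∀ {k n m} (m<n : m < n) {T T' U : 𝔗^ k n} →
                          Similar (fromℕ< m<n) T' T →
                          CompatibleFrom (suc m) T U → CompatibleFrom (suc m) T' U
compatibleFrom-similarˡ m<n {U = U} T'~T h j m<j =
  subst (λ s → CompatAt s (U j)) (sym (T'~T j (above⇒≢ m<n m<j))) (h j m<j)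

compatibleFrom-similarʳ : ∀ {k n m} (m<n : m < n) {T U U' : 𝔗^ k n} →
                          Similar (fromℕ< m<n) U' U →
                          CompatibleFrom (suc m) T U → CompatibleFrom (suc m) T U'
compatibleFrom-similarʳ m<n {T} U'~U h j m<j =
  subst (CompatAt (T j)) (sym (U'~U j (above⇒≢ m<n m<j))) (h j m<j)

module RankFacts {k n : ℕ} {r : 𝔗^ k n → ℕ} (R : IsKMatroidRank k n r) where
  open IsKMatroidRank R

  r-rootAt-≤ : ∀ i T → r (rootAt i T) ≤ r T
  r-rootAt-≤ i T = proj₁ (r-unit i (rootAt i T) T (rootAt-similar i T) (rootAt-self i T))

  -- ī-similar tuples that are both rooted at i have the same rank; this is
  -- how pointwise equalities of tuples are transported to their ranks.
  r-similar-root : ∀ {i F G} → Similar i F G → F i ≡ 𝐨 → G i ≡ 𝐨 → r F ≡ r G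
  r-similar-root {i} {F} {G} F~G Fi Gi =
    ≤-antisym (proj₁ (r-unit i F G F~G Fi)) (proj₁ (r-unit i G F (similar-sym F~G) Gi))

  reduce : ∀ i {T U} → DistinctLeaves (T i) (U i) →
           r (rootAt i T ⊓ U) + r (rootAt i T ⊔ U) ≤ r (rootAt i T) + r U →
           r (T ⊓ rootAt i U) + r (T ⊔ rootAt i U) ≤ r T + r (rootAt i U) →
           r (T ⊓ U) + r (T ⊔ U) ≤ r T + r U
  reduce i {T} {U} (a , b , Ti , Ui , a≢b) ih₁ ih₂ =
    combine (r (T ⊓ U)) (r (T ⊔ U)) (r Wa) (r Wb) (r T) (r U) (r T') (r U')
      (subst (λ x → x + r Wb ≤ r T' + r U) meet₁ ih₁)
      (subst (λ x → x + r Wa ≤ r T + r U') meet₂ ih₂)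
      (subst₂ (λ x y → suc (x + y) ≤ r Wa + r Wb) meetW joinW exchange)
      (r-rootAt-≤ i T) (r-rootAt-≤ i U)
    where
    T' U' Wa Wb : 𝔗^ k n
    T' = rootAt i T
    U' = rootAt i U
    Wa = T ⊔ U'
    Wb = T' ⊔ U

    meet-root : (T ⊓ U) i ≡ 𝐨
    meet-root = trans (cong₂ _⊓₁_ Ti Ui) (⊓₁-distinct a≢b)
    join-root : (T ⊔ U) i ≡ 𝐨
    join-root = trans (cong₂ _⊔₁_ Ti Ui) (⊔₁-distinct a≢b)

    meet₁ : r (T' ⊓ U) ≡ r (T ⊓ U)
    meet₁ = r-similar-root (similar-⊓ (rootAt-similar i T) (similar-refl U))
              (cong (_⊓₁ U i) (rootAt-self i T)) meet-root
    meet₂ : r (T ⊓ U') ≡ r (T ⊓ U)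
    meet₂ = r-similar-root (similar-⊓ (similar-refl T) (rootAt-similar i U))
              (trans (cong (T i ⊓₁_) (rootAt-self i U)) (⊓₁-𝐨 (T i))) meet-root

    Wa~W : Similar i Wa (T ⊔ U)
    Wa~W = similar-⊔ (similar-refl T) (rootAt-similar i U)
    Wb~W : Similar i Wb (T ⊔ U)
    Wb~W = similar-⊔ (rootAt-similar i T) (similar-refl U)
    Wa-i : Wa i ≡ just a
    Wa-i = trans (cong (T i ⊔₁_) (rootAt-self i U)) (trans (⊔₁-𝐨 (T i)) Ti)
    Wb-i : Wb i ≡ just b
    Wb-i = trans (cong (_⊔₁ U i) (rootAt-self i T)) Ui

    meetW : r (Wa ⊓ Wb) ≡ r (T ⊔ U)
    meetW = r-similar-root (similar-trans (similar-⊓ Wa~W Wb~W) (similar-⊓-idem (T ⊔ U)))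
              (trans (cong₂ _⊓₁_ Wa-i Wb-i) (⊓₁-distinct a≢b)) join-root
    joinW : r (Wa ⊔ Wb) ≡ r (T ⊔ U)
    joinW = r-similar-root (similar-trans (similar-⊔ Wa~W Wb~W) (similar-⊔-idem (T ⊔ U)))
              (trans (cong₂ _⊔₁_ Wa-i Wb-i) (⊔₁-distinct a≢b)) join-root

    exchange : suc (r (Wa ⊓ Wb) + r (Wa ⊔ Wb)) ≤ r Wa + r Wb
    exchange = r-twoLeaves i Wa Wb (similar-trans Wa~W (similar-sym Wb~W))
                 (distinct⇒twoLeaves (a , b , Wa-i , Wb-i , a≢b))

  submodularFrom : ∀ m → m ≤ n → ∀ T U → CompatibleFrom m T U →
                   r (T ⊓ U) + r (T ⊔ U) ≤ r T + r U
  submodularFrom zero _ T U h = r-compat T U (λ j → h j z≤n)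
  submodularFrom (suc m) m<n T U h
    with compatAt-or-distinct (T (fromℕ< m<n)) (U (fromℕ< m<n))
  ... | inj₁ compat = submodularFrom m (<⇒≤ m<n) T U (compatibleFrom-step m<n compat h)
  ... | inj₂ distinct = reduce i distinct
        (submodularFrom m (<⇒≤ m<n) (rootAt i T) U
          (compatibleFrom-step m<n (inj₁ (rootAt-self i T))
            (compatibleFrom-similarˡ m<n (rootAt-similar i T) h)))
        (submodularFrom m (<⇒≤ m<n) T (rootAt i U)
          (compatibleFrom-step m<n (inj₂ (inj₁ (rootAt-self i U)))
            (compatibleFrom-similarʳ m<n (rootAt-similar i U) h)))
    where i = fromℕ< m<n

  submodular : KSubmodular r
  submodular T U = submodularFrom n ≤-refl T U
    (λ j n≤j → contradiction (≤-<-trans n≤j (toℕ<n j)) 1+n≰n)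

mainTheorem2 : (k n : ℕ) → k ≥ 1 → n ≥ 1 → (r : 𝔗^ k n → ℕ) →
    IsKMatroidRank k n r → KSubmodular r
mainTheorem2 k n _ _ r R = RankFacts.submodular R
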